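{- Let $G=(V,E)$ be a directed graph and let $P_1,P_2$ be passages of $G$. Then: (i) $\pi_1(P_1)=\pi_1(P_2)$ if and only if $P_1=P_2$, and $P_1=P_2$ if and only if $\pi_2(P_1)=\pi_2(P_2)$; (ii) $P_1\cap P_2=\emptyset$ if and only if $\pi_1(P_1)\cap\pi_1(P_2)=\emptyset$; (iii) $P_1\cap P_2=\emptyset$ if and only if $\pi_2(P_1)\cap\pi_2(P_2)=\emptyset$.
   Context: A directed graph is a pair $G=(V,E)$ with $E\subseteq V\times V$. A set $P\subseteq E$ is a passage of $G$ if for every $(x,y)\in P$ and all $x',y'\in V$ with $(x,y')\in E$ and $(x',y)\in E$, we have $(x,y')\in P$ and $(x',y)\in P$. For $P\subseteq E$, $\pi_1(P)=\{x\mid (x,y)\in P\}$ is the set of initial vertices and $\pi_2(P)=\{y\mid (x,y)\in P\}$ is the set of terminal vertices of $P$. -}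

module Defs where

open import Level using (Level; _⊔_)
open import Data.Product using (_×_; _,_; ∃-syntax)
open import Relation.Unary using (Pred; _⊆_; _∩_; Empty)

record DiGraph (a ℓ : Level) : Set (Level.suc (a ⊔ ℓ)) where
  field
    V : Set a
    E : Pred (V × V) ℓ

module _ {a ℓ p : Level} (G : DiGraph a ℓ) where
  open DiGraph G

  record IsPassage (P : Pred (V × V) p) : Set (a ⊔ ℓ ⊔ p) where
    field
      sub   : P ⊆ E
      close : ∀ {x y x′ y′} → P (x , y) → E (x , y′) → E (x′ , y) →
              P (x , y′) × P (x′ , y)

  π₁ : Pred (V × V) p → Pred V (a ⊔ p)
  π₁ P x = ∃[ y ] P (x , y)

  π₂ : Pred (V × V) p → Pred V (a ⊔ p)
  π₂ P y = ∃[ x ] P (x , y)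

module Submission where

-- A passage P of G = (V, E) is closed under "sharing an endpoint":
-- every edge leaving an initial vertex of P, and every edge entering a
-- terminal vertex of P, again lies in P.  Consequently a passage is the
-- set of ALL edges leaving π₁(P), and equally the set of all edges
-- entering π₂(P).
-- Applying it in both directions gives part (i); the converse holds
-- because π₁ and π₂ respect equality of edge sets.  For (ii) and (iii),
-- a common initial (terminal) vertex of two passages yields, by the same
-- closure, a common edge; conversely a common edge (x , y) gives the
-- common vertex x (resp. y).

open import Defs
open import Level using (Level)
open import Data.Product using (_×_; _,_; proj₁; proj₂)
open import Function.Bundles using (_⇔_; mk⇔)
open import Relation.Unary using (Pred; _⊆_; _≐_; _∩_; Empty)

module _ {a ℓ p : Level} (G : DiGraph a ℓ) where
  open DiGraph G
  open IsPassage

  leaving-edge : ∀ {P : Pred (V × V) p} → IsPassage G P →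
                 ∀ {x y′} → π₁ G P x → E (x , y′) → P (x , y′)
  leaving-edge h (_ , q) e = proj₁ (close h q e (sub h q))

  entering-edge : ∀ {P : Pred (V × V) p} → IsPassage G P →
                  ∀ {x′ y} → π₂ G P y → E (x′ , y) → P (x′ , y)
  entering-edge h (_ , q) e = proj₂ (close h q (sub h q) e)

  π₁-mono : ∀ {P Q : Pred (V × V) p} → P ⊆ Q → π₁ G P ⊆ π₁ G Q
  π₁-mono P⊆Q (y , q) = y , P⊆Q q

  π₂-mono : ∀ {P Q : Pred (V × V) p} → P ⊆ Q → π₂ G P ⊆ π₂ G Q
  π₂-mono P⊆Q (x , q) = x , P⊆Q q

  ⊆-from-π₁ : ∀ {P Q : Pred (V × V) p} → IsPassage G P → Q ⊆ E →
              π₁ G Q ⊆ π₁ G P → Q ⊆ P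
  ⊆-from-π₁ h Q⊆E π₁Q⊆π₁P q = leaving-edge h (π₁Q⊆π₁P (_ , q)) (Q⊆E q)

  ⊆-from-π₂ : ∀ {P Q : Pred (V × V) p} → IsPassage G P → Q ⊆ E →
              π₂ G Q ⊆ π₂ G P → Q ⊆ P
  ⊆-from-π₂ h Q⊆E π₂Q⊆π₂P q = entering-edge h (π₂Q⊆π₂P (_ , q)) (Q⊆E q)

  π₁-resp-≐ : ∀ {P Q : Pred (V × V) p} → P ≐ Q → π₁ G P ≐ π₁ G Q
  π₁-resp-≐ {P} {Q} (P⊆Q , Q⊆P) = π₁-mono {P} {Q} P⊆Q , π₁-mono {Q} {P} Q⊆P

  π₂-resp-≐ : ∀ {P Q : Pred (V × V) p} → P ≐ Q → π₂ G P ≐ π₂ G Q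
  π₂-resp-≐ {P} {Q} (P⊆Q , Q⊆P) = π₂-mono {P} {Q} P⊆Q , π₂-mono {Q} {P} Q⊆P

  ≐-from-π₁ : ∀ {P₁ P₂ : Pred (V × V) p} → IsPassage G P₁ → IsPassage G P₂ →
              π₁ G P₁ ≐ π₁ G P₂ → P₁ ≐ P₂
  ≐-from-π₁ h₁ h₂ (⊆₁₂ , ⊆₂₁) = ⊆-from-π₁ h₂ (sub h₁) ⊆₁₂ , ⊆-from-π₁ h₁ (sub h₂) ⊆₂₁

  ≐-from-π₂ : ∀ {P₁ P₂ : Pred (V × V) p} → IsPassage G P₁ → IsPassage G P₂ →
              π₂ G P₁ ≐ π₂ G P₂ → P₁ ≐ P₂
  ≐-from-π₂ h₁ h₂ (⊆₁₂ , ⊆₂₁) = ⊆-from-π₂ h₂ (sub h₁) ⊆₁₂ , ⊆-from-π₂ h₁ (sub h₂) ⊆₂₁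

  disjoint-from-π₁ : ∀ {P₁ P₂ : Pred (V × V) p} →
                     Empty (π₁ G P₁ ∩ π₁ G P₂) → Empty (P₁ ∩ P₂)
  disjoint-from-π₁ disj (x , y) (q₁ , q₂) = disj x ((y , q₁) , (y , q₂))

  disjoint-from-π₂ : ∀ {P₁ P₂ : Pred (V × V) p} →
                     Empty (π₂ G P₁ ∩ π₂ G P₂) → Empty (P₁ ∩ P₂)
  disjoint-from-π₂ disj (x , y) (q₁ , q₂) = disj y ((x , q₁) , (x , q₂))

  -- Conversely, a set of edges Q disjoint from a passage P has initial
  -- vertices disjoint from those of P: a common initial vertex x with
  -- (x , y) ∈ Q would put the edge (x , y) into P as well.
  π₁-disjoint : ∀ {Q P : Pred (V × V) p} → Q ⊆ E → IsPassage G P →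
                Empty (Q ∩ P) → Empty (π₁ G Q ∩ π₁ G P)
  π₁-disjoint Q⊆E h disj x ((y , q) , x∈π₁P) =
    disj (x , y) (q , leaving-edge h x∈π₁P (Q⊆E q))

  π₂-disjoint : ∀ {Q P : Pred (V × V) p} → Q ⊆ E → IsPassage G P →
                Empty (Q ∩ P) → Empty (π₂ G Q ∩ π₂ G P)
  π₂-disjoint Q⊆E h disj y ((x , q) , y∈π₂P) =
    disj (x , y) (q , entering-edge h y∈π₂P (Q⊆E q))

mainTheorem2 : ∀ {a ℓ p : Level} (G : DiGraph a ℓ) (P₁ P₂ : Pred (DiGraph.V G × DiGraph.V G) p) →
    IsPassage G P₁ → IsPassage G P₂ →
    ((π₁ G P₁ ≐ π₁ G P₂) ⇔ (P₁ ≐ P₂)) × ((P₁ ≐ P₂) ⇔ (π₂ G P₁ ≐ π₂ G P₂))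
    × (Empty (P₁ ∩ P₂) ⇔ Empty (π₁ G P₁ ∩ π₁ G P₂))
    × (Empty (P₁ ∩ P₂) ⇔ Empty (π₂ G P₁ ∩ π₂ G P₂))
-- Each part is an equivalence whose two directions are the lemmas above.
mainTheorem2 G P₁ P₂ h₁ h₂ =
    mk⇔ (≐-from-π₁ G h₁ h₂) (π₁-resp-≐ G)
  , mk⇔ (π₂-resp-≐ G) (≐-from-π₂ G h₁ h₂)
  , mk⇔ (π₁-disjoint G (IsPassage.sub h₁) h₂) (disjoint-from-π₁ G)
  , mk⇔ (π₂-disjoint G (IsPassage.sub h₁) h₂) (disjoint-from-π₂ G)
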